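{- Let $G=(V,E)$ and $G'=(V',E')$ denote finite simple graphs such that $V\cap V'=\emptyset$. If $G$ is connected and $\lvert V\rvert\geq 2$, then every minimal fort of $G$ is a minimal fort of $G\vee G'$.
   Context: A non-empty vertex subset $F$ of a graph is a fort if no vertex outside $F$ has exactly one neighbor in $F$; a fort is minimal if every proper subset is not a fort. The join $G\vee G'$ has vertex set $V\cup V'$ and edge set $E\cup E'\cup\{\{u,u'\}\colon u\in V,\,u'\in V'\}$. -}

module Defs where

open import Data.Nat using (ℕ; _+_; _≥_)
open import Data.Bool using (Bool; true; false; _∨_)
open import Data.Fin using (Fin; _↑ˡ_; _↑ʳ_; splitAt)
open import Data.Sum using (inj₁; inj₂)
open import Data.Product using (∃; _×_)
open import Data.Vec using (_++_; tabulate)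
open import Data.Fin.Subset using (Subset; _∈_; _∉_; _⊆_; _∩_; ∣_∣; ⊥)
open import Relation.Binary.PropositionalEquality using (_≡_; refl)
open import Relation.Nullary using (¬_)

record Graph (n : ℕ) : Set where
  field
    adj   : Fin n → Fin n → Bool
    sym   : ∀ u v → adj u v ≡ adj v u
    irrefl : ∀ v → adj v v ≡ false
open Graph public

N : ∀ {n} → Graph n → Fin n → Subset n
N G v = tabulate (adj G v)

data Reach {n} (G : Graph n) : Fin n → Fin n → Set where
  here : ∀ {v} → Reach G v v
  step : ∀ {u v w} → adj G u v ≡ true → Reach G v w → Reach G u w

Connected : ∀ {n} → Graph n → Set
Connected G = ∀ u v → Reach G u v

IsFort : ∀ {n} → Graph n → Subset n → Set
IsFort {n} G F = (∃ λ v → v ∈ F) × (∀ v → v ∉ F → ¬ (∣ N G v ∩ F ∣ ≡ 1))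

IsMinimalFort : ∀ {n} → Graph n → Subset n → Set
IsMinimalFort G F = IsFort G F × (∀ F′ → F′ ⊆ F → ¬ (F′ ≡ F) → ¬ IsFort G F′)

-- the join G ∨ G′ on Fin (n + m): V = first n vertices, V′ = last m vertices
joinAdj : ∀ {n m} → Graph n → Graph m → Fin (n + m) → Fin (n + m) → Bool
joinAdj {n} G H x y with splitAt n x | splitAt n y
... | inj₁ u | inj₁ v = adj G u v
... | inj₂ u | inj₂ v = adj H u v
... | inj₁ _ | inj₂ _ = true
... | inj₂ _ | inj₁ _ = true


joinAdj-sym : ∀ {n m} (G : Graph n) (H : Graph m) x y → joinAdj G H x y ≡ joinAdj G H y x
joinAdj-sym {n} G H x y with splitAt n x | splitAt n y
... | inj₁ u | inj₁ v = sym G u v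
... | inj₂ u | inj₂ v = sym H u v
... | inj₁ _ | inj₂ _ = refl
... | inj₂ _ | inj₁ _ = refl

joinAdj-irrefl : ∀ {n m} (G : Graph n) (H : Graph m) x → joinAdj G H x x ≡ false
joinAdj-irrefl {n} G H x with splitAt n x
... | inj₁ u = irrefl G u
... | inj₂ u = irrefl H u

_⋁_ : ∀ {n m} → Graph n → Graph m → Graph (n + m)
G ⋁ H = record { adj = joinAdj G H ; sym = joinAdj-sym G H ; irrefl = joinAdj-irrefl G H }

embedL : ∀ {n} m → Subset n → Subset (n + m)
embedL m F = F ++ ⊥

{-# OPTIONS --safe #-}
-- In G ∨ G′ a vertex of V′ is adjacent to all of V, so it has exactly |F| neighbours in F;
-- a vertex of V has the same neighbours in V as it has in G.  Hence F is a fort of the join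
-- as soon as |F| ≠ 1, and this holds because G has no isolated vertex: if F = {v} and w is a
-- neighbour of v, then w ∉ F has exactly one neighbour in F.  Conversely, a fort of the join
-- contained in F lies in V and is therefore a fort of G, which transfers minimality.
module Submission where

open import Defs hiding (sym)
open import Data.Bool using (Bool; true; _∧_)
open import Data.Empty using (⊥-elim)
open import Data.Fin using (Fin; zero; suc; _↑ˡ_; _↑ʳ_; _≟_)
open import Data.Fin.Properties using (splitAt-↑ˡ; splitAt-↑ʳ)
open import Data.Fin.Subset
  using (Subset; inside; outside; Nonempty; _∈_; _∉_; _⊆_; _∩_; _-_; ∣_∣; ⊥; ⊤)
open import Data.Fin.Subset.Properties
  using (Empty-unique; ∉⊥; ∣⊥∣≡0; ∩-zeroʳ; ∩-identityˡ; x∈p⇒∣p-x∣<∣p∣; x∈p∧x≢y⇒x∈p-y;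
         p⊆q⇒∣p∣≤∣q∣; p∩q⊆q; x∈p∩q⁺)
open import Data.Nat using (ℕ; _+_; _≤_; _≥_; _<_; s≤s; z≤n)
open import Data.Nat.Properties using (+-identityʳ; ≤-<-trans; <-irrefl; ≤-antisym)
open import Data.Product using (∃; _×_; _,_)
open import Data.Vec using ([]; _∷_; _++_; tabulate; replicate; allFin; here; there)
import Data.Vec as Vec
open import Data.Vec.Properties
  using (tabulate-cong; tabulate-allFin; map-const; zipWith-++; lookup∘tabulate; lookup⇒[]=)
open import Function using (_∘_; const)
open import Relation.Binary.PropositionalEquality
  using (_≡_; _≢_; refl; sym; trans; cong; cong₂; subst; module ≡-Reasoning)
open import Relation.Nullary using (¬_; yes; no)

private
  variable
    n m : ℕ

data Summand n m : Fin (n + m) → Set where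
  inl : (u : Fin n) → Summand n m (u ↑ˡ m)
  inr : (v : Fin m) → Summand n m (n ↑ʳ v)

summand : ∀ n m (x : Fin (n + m)) → Summand n m x
summand ℕ.zero    m x       = inr x
summand (ℕ.suc n) m zero    = inl zero
summand (ℕ.suc n) m (suc x) with summand n m x
... | inl u = inl (suc u)
... | inr v = inr v

tabulate-++ : ∀ n (f : Fin (n + m) → Bool) →
              tabulate f ≡ tabulate (f ∘ (_↑ˡ m)) ++ tabulate (f ∘ (n ↑ʳ_))
tabulate-++ ℕ.zero    f = refl
tabulate-++ (ℕ.suc n) f = cong (f zero ∷_) (tabulate-++ n (f ∘ suc))

tabulate-const : ∀ n {A : Set} (x : A) → tabulate {n = n} (const x) ≡ replicate n x
tabulate-const n x = trans (tabulate-allFin (const x)) (map-const (allFin n) x)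

∣p++q∣≡∣p∣+∣q∣ : (p : Subset n) (q : Subset m) → ∣ p ++ q ∣ ≡ ∣ p ∣ + ∣ q ∣
∣p++q∣≡∣p∣+∣q∣ []            q = refl
∣p++q∣≡∣p∣+∣q∣ (inside ∷ p)  q = cong ℕ.suc (∣p++q∣≡∣p∣+∣q∣ p q)
∣p++q∣≡∣p∣+∣q∣ (outside ∷ p) q = ∣p++q∣≡∣p∣+∣q∣ p q

∣p++q∩r++⊥∣≡∣p∩r∣ : (p r : Subset n) (q : Subset m) → ∣ (p ++ q) ∩ (r ++ ⊥) ∣ ≡ ∣ p ∩ r ∣
∣p++q∩r++⊥∣≡∣p∩r∣ {m = m} p r q = begin
  ∣ (p ++ q) ∩ (r ++ ⊥) ∣     ≡⟨ cong ∣_∣ (zipWith-++ _∧_ p q r ⊥) ⟩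
  ∣ (p ∩ r) ++ (q ∩ ⊥) ∣      ≡⟨ ∣p++q∣≡∣p∣+∣q∣ (p ∩ r) (q ∩ ⊥) ⟩
  ∣ p ∩ r ∣ + ∣ q ∩ ⊥ ∣       ≡⟨ cong (λ s → ∣ p ∩ r ∣ + ∣ s ∣) (∩-zeroʳ q) ⟩
  ∣ p ∩ r ∣ + ∣ ⊥ {n = m} ∣   ≡⟨ cong (∣ p ∩ r ∣ +_) (∣⊥∣≡0 m) ⟩
  ∣ p ∩ r ∣ + 0               ≡⟨ +-identityʳ _ ⟩
  ∣ p ∩ r ∣                   ∎
  where open ≡-Reasoning

x∈p⇒0<∣p∣ : {x : Fin n} {p : Subset n} → x ∈ p → 0 < ∣ p ∣
x∈p⇒0<∣p∣ x∈p = ≤-<-trans z≤n (x∈p⇒∣p-x∣<∣p∣ x∈p)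

∣p∣≡1∧x∈p∧y∈p⇒x≡y : {x y : Fin n} {p : Subset n} → ∣ p ∣ ≡ 1 → x ∈ p → y ∈ p → x ≡ y
∣p∣≡1∧x∈p∧y∈p⇒x≡y {x = x} {y} {p} ∣p∣≡1 x∈p y∈p with x ≟ y
... | yes x≡y = x≡y
... | no  x≢y = ⊥-elim (<-irrefl refl (≤-<-trans 0<∣p-x∣ ∣p-x∣<1))
  where
  0<∣p-x∣ : 0 < ∣ p - x ∣
  0<∣p-x∣ = x∈p⇒0<∣p∣ (x∈p∧x≢y⇒x∈p-y y∈p (x≢y ∘ sym))
  ∣p-x∣<1 : ∣ p - x ∣ < 1
  ∣p-x∣<1 = subst (∣ p - x ∣ <_) ∣p∣≡1 (x∈p⇒∣p-x∣<∣p∣ x∈p)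

∈-++⁺ˡ : {x : Fin n} {p : Subset n} {q : Subset m} → x ∈ p → x ↑ˡ m ∈ p ++ q
∈-++⁺ˡ here        = here
∈-++⁺ˡ (there x∈p) = there (∈-++⁺ˡ x∈p)

∈-++⁺ʳ : {y : Fin m} (p : Subset n) {q : Subset m} → y ∈ q → n ↑ʳ y ∈ p ++ q
∈-++⁺ʳ []      y∈q = y∈q
∈-++⁺ʳ (_ ∷ p) y∈q = there (∈-++⁺ʳ p y∈q)

∈-++⁻ˡ : {x : Fin n} {p : Subset n} {q : Subset m} → x ↑ˡ m ∈ p ++ q → x ∈ p
∈-++⁻ˡ {x = zero}  {_ ∷ p} here        = here
∈-++⁻ˡ {x = suc x} {_ ∷ p} (there x∈p) = there (∈-++⁻ˡ x∈p)

∈-++⁻ʳ : {y : Fin m} (p : Subset n) {q : Subset m} → n ↑ʳ y ∈ p ++ q → y ∈ q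
∈-++⁻ʳ []      y∈q         = y∈q
∈-++⁻ʳ (_ ∷ p) (there y∈q) = ∈-++⁻ʳ p y∈q

embedL-nonempty⁻ : (A : Subset n) → Nonempty (embedL m A) → Nonempty A
embedL-nonempty⁻ {n} {m} A (x , x∈) with summand n m x
... | inl u = u , ∈-++⁻ˡ x∈
... | inr v = ⊥-elim (∉⊥ (∈-++⁻ʳ A x∈))

⊆embedL⇒≡embedL : {F : Subset n} (F′ : Subset (n + m)) → F′ ⊆ embedL m F →
                  ∃ λ A → A ⊆ F × F′ ≡ embedL m A
⊆embedL⇒≡embedL {n} {m} {F} F′ F′⊆ with Vec.splitAt n F′
... | A , B , refl = A , ∈-++⁻ˡ ∘ F′⊆ ∘ ∈-++⁺ˡ , cong (A ++_) (Empty-unique B-empty)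
  where
  B-empty : ¬ Nonempty B
  B-empty (y , y∈B) = ∉⊥ (∈-++⁻ʳ F (F′⊆ (∈-++⁺ʳ A y∈B)))

HasNeighbour : Graph n → Fin n → Set
HasNeighbour G v = ∃ λ w → adj G v w ≡ true

Reach⇒HasNeighbour : (G : Graph n) {u v : Fin n} → Reach G u v → u ≢ v → HasNeighbour G u
Reach⇒HasNeighbour G here                 u≢u = ⊥-elim (u≢u refl)
Reach⇒HasNeighbour G (step {v = w} u~w _) _ = w , u~w

connected⇒HasNeighbour : (G : Graph n) → Connected G → n ≥ 2 → ∀ v → HasNeighbour G v
connected⇒HasNeighbour G conn (s≤s (s≤s _)) zero    =
  Reach⇒HasNeighbour G (conn zero (suc zero)) λ ()
connected⇒HasNeighbour G conn (s≤s (s≤s _)) (suc v) =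
  Reach⇒HasNeighbour G (conn (suc v) zero) λ ()

adj⇒∈N : (G : Graph n) {v w : Fin n} → adj G v w ≡ true → w ∈ N G v
adj⇒∈N G {v} {w} v~w = lookup⇒[]= w (N G v) (trans (lookup∘tabulate (adj G v) w) v~w)

∣fort∣≢1 : (G : Graph n) → (∀ v → HasNeighbour G v) → ∀ {F} → IsFort G F → ∣ F ∣ ≢ 1
∣fort∣≢1 G nbr {F} ((v , v∈F) , closed) ∣F∣≡1 with nbr v
... | w , v~w = closed w w∉F ∣N[w]∩F∣≡1
  where
  w∉F : w ∉ F
  w∉F w∈F with ∣p∣≡1∧x∈p∧y∈p⇒x≡y ∣F∣≡1 v∈F w∈F
  ... | refl with trans (sym v~w) (irrefl G v)
  ...   | ()
  v∈N[w]∩F : v ∈ N G w ∩ F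
  v∈N[w]∩F = x∈p∩q⁺ (adj⇒∈N G (trans (Graph.sym G w v) v~w) , v∈F)
  ∣N[w]∩F∣≡1 : ∣ N G w ∩ F ∣ ≡ 1
  ∣N[w]∩F∣≡1 = ≤-antisym (subst (∣ N G w ∩ F ∣ ≤_) ∣F∣≡1 (p⊆q⇒∣p∣≤∣q∣ (p∩q⊆q (N G w) F)))
                          (x∈p⇒0<∣p∣ v∈N[w]∩F)

module _ (G : Graph n) (H : Graph m) where

  ⋁-adj-↑ˡ-↑ˡ : ∀ u w → adj (G ⋁ H) (u ↑ˡ m) (w ↑ˡ m) ≡ adj G u w
  ⋁-adj-↑ˡ-↑ˡ u w rewrite splitAt-↑ˡ n u m | splitAt-↑ˡ n w m = refl

  ⋁-adj-↑ˡ-↑ʳ : ∀ u v → adj (G ⋁ H) (u ↑ˡ m) (n ↑ʳ v) ≡ true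
  ⋁-adj-↑ˡ-↑ʳ u v rewrite splitAt-↑ˡ n u m | splitAt-↑ʳ n m v = refl

  ⋁-adj-↑ʳ-↑ˡ : ∀ v u → adj (G ⋁ H) (n ↑ʳ v) (u ↑ˡ m) ≡ true
  ⋁-adj-↑ʳ-↑ˡ v u rewrite splitAt-↑ʳ n m v | splitAt-↑ˡ n u m = refl

  ⋁-adj-↑ʳ-↑ʳ : ∀ v w → adj (G ⋁ H) (n ↑ʳ v) (n ↑ʳ w) ≡ adj H v w
  ⋁-adj-↑ʳ-↑ʳ v w rewrite splitAt-↑ʳ n m v | splitAt-↑ʳ n m w = refl

  N-⋁-↑ˡ : ∀ u → N (G ⋁ H) (u ↑ˡ m) ≡ N G u ++ ⊤
  N-⋁-↑ˡ u = trans (tabulate-++ n _) (cong₂ _++_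
    (tabulate-cong (⋁-adj-↑ˡ-↑ˡ u))
    (trans (tabulate-cong (⋁-adj-↑ˡ-↑ʳ u)) (tabulate-const m true)))

  N-⋁-↑ʳ : ∀ v → N (G ⋁ H) (n ↑ʳ v) ≡ ⊤ ++ N H v
  N-⋁-↑ʳ v = trans (tabulate-++ n _) (cong₂ _++_
    (trans (tabulate-cong (⋁-adj-↑ʳ-↑ˡ v)) (tabulate-const n true))
    (tabulate-cong (⋁-adj-↑ʳ-↑ʳ v)))

  ∣N-⋁-↑ˡ∩embedL∣ : ∀ u (A : Subset n) → ∣ N (G ⋁ H) (u ↑ˡ m) ∩ embedL m A ∣ ≡ ∣ N G u ∩ A ∣
  ∣N-⋁-↑ˡ∩embedL∣ u A rewrite N-⋁-↑ˡ u = ∣p++q∩r++⊥∣≡∣p∩r∣ (N G u) A ⊤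

  ∣N-⋁-↑ʳ∩embedL∣ : ∀ v (A : Subset n) → ∣ N (G ⋁ H) (n ↑ʳ v) ∩ embedL m A ∣ ≡ ∣ A ∣
  ∣N-⋁-↑ʳ∩embedL∣ v A rewrite N-⋁-↑ʳ v =
    trans (∣p++q∩r++⊥∣≡∣p∩r∣ ⊤ A (N H v)) (cong ∣_∣ (∩-identityˡ A))

  embedL-fort⁺ : {A : Subset n} → IsFort G A → ∣ A ∣ ≢ 1 → IsFort (G ⋁ H) (embedL m A)
  embedL-fort⁺ {A} ((v , v∈A) , closed) ∣A∣≢1 = (v ↑ˡ m , ∈-++⁺ˡ v∈A) , closed′
    where
    closed′ : ∀ x → x ∉ embedL m A → ¬ ∣ N (G ⋁ H) x ∩ embedL m A ∣ ≡ 1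
    closed′ x x∉ with summand n m x
    ... | inl u = closed u (x∉ ∘ ∈-++⁺ˡ) ∘ trans (sym (∣N-⋁-↑ˡ∩embedL∣ u A))
    ... | inr v = ∣A∣≢1 ∘ trans (sym (∣N-⋁-↑ʳ∩embedL∣ v A))

  embedL-fort⁻ : {A : Subset n} → IsFort (G ⋁ H) (embedL m A) → IsFort G A
  embedL-fort⁻ {A} (nonempty , closed) =
    embedL-nonempty⁻ A nonempty ,
    λ u u∉A → closed (u ↑ˡ m) (u∉A ∘ ∈-++⁻ˡ) ∘ trans (∣N-⋁-↑ˡ∩embedL∣ u A)

proposition5p1 : ∀ {n m} (G : Graph n) (G′ : Graph m) →
    Connected G → n ≥ 2 →
    ∀ (F : Subset n) → IsMinimalFort G F → IsMinimalFort (G ⋁ G′) (embedL m F)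
proposition5p1 {n} {m} G G′ conn n≥2 F (fortF , minimalF) =
  embedL-fort⁺ G G′ fortF ∣F∣≢1 , minimal
  where
  ∣F∣≢1 : ∣ F ∣ ≢ 1
  ∣F∣≢1 = ∣fort∣≢1 G (connected⇒HasNeighbour G conn n≥2) fortF
  minimal : ∀ F′ → F′ ⊆ embedL m F → ¬ F′ ≡ embedL m F → ¬ IsFort (G ⋁ G′) F′
  minimal F′ F′⊆ F′≢ fortF′ with ⊆embedL⇒≡embedL {m = m} F′ F′⊆
  ... | A , A⊆F , refl = minimalF A A⊆F (F′≢ ∘ cong (embedL m)) (embedL-fort⁻ G G′ fortF′)
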